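{- There is an infinite family of oriented simple graphs such that each orientation is a local optimum for the $\ell_2$-potential $\Phi=\sum_v\mathrm{disc}(v)^2$ (no single edge flip strictly decreases $\Phi$), and a graph of the family with $n$ vertices has discrepancy $\max_v|\mathrm{disc}(v)|=\Omega(n^{1/3})$.
   Context: For an orientation of a graph, $\mathrm{disc}(v)=|\delta_{\mathrm{in}}(v)|-|\delta_{\mathrm{out}}(v)|$. Flipping an edge $u\to v$ to $v\to u$ strictly decreases $\Phi$ iff $\mathrm{disc}(v)>\mathrm{disc}(u)+2$. -}

module Defs where

open import Data.Nat as ℕ using (ℕ; _⊔_)
open import Data.Integer as ℤ using (ℤ; ∣_∣; _-_; _*_; _+_)
open import Data.Bool using (Bool; true; false; if_then_else_; _∧_; T)
open import Data.Fin using (Fin; _≟_)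
open import Data.List using (List; map; foldr; allFin)
open import Relation.Nullary.Decidable using (⌊_⌋)
open import Relation.Binary.PropositionalEquality using (_≡_)
open import Data.Product using (_×_)
open import Relation.Nullary using (¬_)

-- An orientation of a graph on vertex set Fin n, given by its arc relation:
-- arc u v ≡ true  iff the graph has the edge {u,v}, oriented u → v.
Orientation : ℕ → Set
Orientation n = Fin n → Fin n → Bool

-- Simple graph oriented: no loops, and each edge carries exactly one direction
-- (so no pair u,v carries both u → v and v → u; no multi-edges by construction).
OrientedSimple : ∀ {n} → Orientation n → Set
OrientedSimple {n} a =
  ((v : Fin n) → a v v ≡ false) ×
  ((u v : Fin n) → ¬ (T (a u v) × T (a v u)))

boolToℕ : Bool → ℕ
boolToℕ true  = 1
boolToℕ false = 0

sumℕ : ∀ {n} → (Fin n → ℕ) → ℕ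
sumℕ {n} f = foldr ℕ._+_ 0 (map f (allFin n))

sumℤ : ∀ {n} → (Fin n → ℤ) → ℤ
sumℤ {n} f = foldr _+_ (ℤ.+ 0) (map f (allFin n))

indeg : ∀ {n} → Orientation n → Fin n → ℕ
indeg a v = sumℕ (λ u → boolToℕ (a u v))

outdeg : ∀ {n} → Orientation n → Fin n → ℕ
outdeg a v = sumℕ (λ w → boolToℕ (a v w))

disc : ∀ {n} → Orientation n → Fin n → ℤ
disc a v = ℤ.+ (indeg a v) - ℤ.+ (outdeg a v)

Φ : ∀ {n} → Orientation n → ℤ
Φ a = sumℤ (λ v → disc a v * disc a v)

flip : ∀ {n} → Orientation n → Fin n → Fin n → Orientation n
flip a u v x y =
  if ⌊ x ≟ v ⌋ ∧ ⌊ y ≟ u ⌋ then true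
  else if ⌊ x ≟ u ⌋ ∧ ⌊ y ≟ v ⌋ then false
  else a x y

LocalOpt : ∀ {n} → Orientation n → Set
LocalOpt {n} a = (u v : Fin n) → T (a u v) → Φ a ℤ.≤ Φ (flip a u v)

discrepancy : ∀ {n} → Orientation n → ℕ
discrepancy {n} a = foldr _⊔_ 0 (map (λ v → ∣ disc a v ∣) (allFin n))

{-# OPTIONS --safe #-}
module Submission where

-- Flipping an arc u → v changes Φ by 4 (disc u − disc v + 2), so an orientation is a local
-- optimum as soon as disc v ≤ disc u + 2 along every arc u → v.  The example is layered: layer l
-- holds size l vertices, each pointing to every vertex of layer l + 1, so a vertex of layer l has
-- discrepancy size (l − 1) − size (l + 1) and the arc condition becomes a condition on the second
-- differences of size.  It holds for size l = k (N − k) with k = ⌊l/2⌋, which needs 2N layers of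
-- at most N² vertices, i.e. O(N³) vertices, while a vertex of layer 2 has discrepancy −(N − 1).

open import Defs
open import Data.Bool using (Bool; true; false; T; if_then_else_; _∧_)
open import Data.Bool.Properties using (∧-zeroʳ; ∧-identityʳ; T-∧; T-≡)
open import Data.Empty using (⊥-elim)
open import Data.Fin using (Fin; zero; suc; _≟_; toℕ; fromℕ<; _↑ˡ_; _↑ʳ_; combine; remQuot)
open import Data.Fin.Properties using (toℕ<n; toℕ-fromℕ<; remQuot-combine)
open import Data.Integer as ℤ using (ℤ; +_)
import Data.Integer.Properties as ℤ
open import Data.Integer.Tactic.RingSolver using (solve-∀)
open import Data.List using (foldr; map; allFin; tabulate)
open import Data.List.Properties using (map-tabulate)
open import Data.Nat as ℕ using (ℕ; zero; suc)
import Data.Nat.Properties as ℕ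
open import Data.Nat.Tactic.RingSolver using () renaming (solve-∀ to ℕ-solve-∀)
open import Data.Product as Product using (Σ; _×_; _,_; proj₁; proj₂)
open import Data.Sum using (inj₁; inj₂)
open import Data.Unit using (tt)
import Data.Vec.Functional as Vector
open import Function using (_∘_; id)
open import Function.Bundles using (Equivalence)
open import Relation.Binary.PropositionalEquality
open import Relation.Nullary using (¬_; yes; no)
open import Relation.Nullary.Decidable using (⌊_⌋; toWitness; ⌊⌋-map′)

import Algebra.Properties.Semiring.Sum
module ℤΣ = Algebra.Properties.Semiring.Sum ℤ.+-*-semiring
module ℕΣ = Algebra.Properties.Semiring.Sum ℕ.+-*-semiring

foldr-tabulate : ∀ {a b} {A : Set a} {B : Set b} (_∙_ : A → B → B) e {n} (f : Fin n → A) →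
                 foldr _∙_ e (tabulate f) ≡ Vector.foldr _∙_ e f
foldr-tabulate _∙_ e {zero}  f = refl
foldr-tabulate _∙_ e {suc n} f = cong (f zero ∙_) (foldr-tabulate _∙_ e (f ∘ suc))

foldr-map-allFin : ∀ {a b} {A : Set a} {B : Set b} (_∙_ : A → B → B) e {n} (f : Fin n → A) →
                   foldr _∙_ e (map f (allFin n)) ≡ Vector.foldr _∙_ e f
foldr-map-allFin _∙_ e f = trans (cong (foldr _∙_ e) (map-tabulate id f)) (foldr-tabulate _∙_ e f)

module _ where

  open import Data.Integer using (_+_; _-_; _*_; -_; _≤_)

  sumℤ≡sum : ∀ {n} (f : Fin n → ℤ) → sumℤ f ≡ ℤΣ.sum f
  sumℤ≡sum = foldr-map-allFin _+_ (+ 0)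

  +sumℕ≡sum : ∀ {n} (f : Fin n → ℕ) → + sumℕ f ≡ ℤΣ.sum (+_ ∘ f)
  +sumℕ≡sum f = trans (cong +_ (foldr-map-allFin ℕ._+_ 0 f)) (+-sum f)
    where
    +-sum : ∀ {n} (f : Fin n → ℕ) → + ℕΣ.sum f ≡ ℤΣ.sum (+_ ∘ f)
    +-sum {zero}  f = refl
    +-sum {suc n} f = cong (_+_ (+ f zero)) (+-sum (f ∘ suc))

  ∑-distrib-+₃ : ∀ {n} (f g h : Fin n → ℤ) →
                 ℤΣ.sum (λ w → f w + g w + h w) ≡ ℤΣ.sum f + ℤΣ.sum g + ℤΣ.sum h
  ∑-distrib-+₃ f g h =
    trans (ℤΣ.∑-distrib-+ (λ w → f w + g w) h) (cong (_+ ℤΣ.sum h) (ℤΣ.∑-distrib-+ f g))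

  ∑-δ : ∀ {n} (g : Bool → ℤ) (u : Fin n) → g false ≡ + 0 → ℤΣ.sum (λ w → g ⌊ w ≟ u ⌋) ≡ g true
  ∑-δ {suc n} g zero g0 = begin
    g true + ℤΣ.sum {n} (λ _ → g false)
      ≡⟨ cong (_+_ (g true)) (ℤΣ.sum-cong-≗ {n} {λ _ → g false} (λ _ → g0)) ⟩
    g true + ℤΣ.sum {n} (λ _ → + 0)
      ≡⟨ cong (_+_ (g true)) (ℤΣ.sum-replicate-zero n) ⟩
    g true + + 0
      ≡⟨ ℤ.+-identityʳ (g true) ⟩
    g true
      ∎
    where open ≡-Reasoning
  ∑-δ {suc n} g (suc u) g0 = begin
    g false + ℤΣ.sum (λ w → g ⌊ suc w ≟ suc u ⌋)
      ≡⟨ cong₂ _+_ g0 (ℤΣ.sum-cong-≗ (λ w → cong g (⌊⌋-map′ _ _ (w ≟ u)))) ⟩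
    + 0 + ℤΣ.sum (λ w → g ⌊ w ≟ u ⌋)
      ≡⟨ ℤ.+-identityˡ _ ⟩
    ℤΣ.sum (λ w → g ⌊ w ≟ u ⌋)
      ≡⟨ ∑-δ g u g0 ⟩
    g true
      ∎
    where open ≡-Reasoning

  𝟙 : Bool → ℤ
  𝟙 b = + boolToℕ b

  𝟙-override : ∀ p r A → (T p → A ≡ false) → (T r → A ≡ true) →
               𝟙 (if p then true else if r then false else A) ≡ 𝟙 A + 𝟙 p - 𝟙 r
  𝟙-override true  _     true  A-false _      with () ← A-false tt
  𝟙-override true  true  false _       A-true with () ← A-true tt
  𝟙-override true  false false _       _      = refl
  𝟙-override false true  true  _       _      = refl
  𝟙-override false true  false _       A-true with () ← A-true tt
  𝟙-override false false true  _       _      = refl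
  𝟙-override false false false _       _      = refl

  T-≟∧≟ : ∀ {n} (y x z w : Fin n) → T (⌊ y ≟ x ⌋ ∧ ⌊ z ≟ w ⌋) → y ≡ x × z ≡ w
  T-≟∧≟ y x z w t =
    Product.map (toWitness {a? = y ≟ x}) (toWitness {a? = z ≟ w}) (Equivalence.to T-∧ t)

  module _ {n} {a : Orientation n} (simple : OrientedSimple a) {u v : Fin n} (u→v : T (a u v)) where

    a′ : Orientation n
    a′ = flip a u v

    private
      ¬v→u : a v u ≡ false
      ¬v→u with a v u in eq
      ... | false = refl
      ... | true  = ⊥-elim (proj₂ simple u v (u→v , subst T (sym eq) tt))

      u≢v : u ≢ v
      u≢v refl = subst T (proj₁ simple u) u→v

    𝟙-flip : ∀ y z → 𝟙 (a′ y z) ≡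
             𝟙 (a y z) + 𝟙 (⌊ y ≟ v ⌋ ∧ ⌊ z ≟ u ⌋) - 𝟙 (⌊ y ≟ u ⌋ ∧ ⌊ z ≟ v ⌋)
    𝟙-flip y z = 𝟙-override _ _ (a y z) vu-absent uv-present
      where
      vu-absent : T (⌊ y ≟ v ⌋ ∧ ⌊ z ≟ u ⌋) → a y z ≡ false
      vu-absent t with refl , refl ← T-≟∧≟ y v z u t = ¬v→u
      uv-present : T (⌊ y ≟ u ⌋ ∧ ⌊ z ≟ v ⌋) → a y z ≡ true
      uv-present t with refl , refl ← T-≟∧≟ y u z v t = Equivalence.to T-≡ u→v

    indeg-flip : ∀ x → + indeg a′ x ≡ + indeg a x + 𝟙 ⌊ x ≟ u ⌋ - 𝟙 ⌊ x ≟ v ⌋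
    indeg-flip x = begin
      + indeg a′ x
        ≡⟨ +sumℕ≡sum (λ w → boolToℕ (a′ w x)) ⟩
      ℤΣ.sum (λ w → 𝟙 (a′ w x))
        ≡⟨ ℤΣ.sum-cong-≗ (λ w → 𝟙-flip w x) ⟩
      ℤΣ.sum (λ w → old w + new w - gone w)
        ≡⟨ ∑-distrib-+₃ old new (-_ ∘ gone) ⟩
      ℤΣ.sum old + ℤΣ.sum new + ℤΣ.sum (-_ ∘ gone)
        ≡⟨ cong₂ _+_ (cong₂ _+_ (sym (+sumℕ≡sum (λ w → boolToℕ (a w x))))
                                (∑-δ (λ c → 𝟙 (c ∧ ⌊ x ≟ u ⌋)) v refl))
                     (∑-δ (λ c → - 𝟙 (c ∧ ⌊ x ≟ v ⌋)) u refl) ⟩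
      + indeg a x + 𝟙 ⌊ x ≟ u ⌋ - 𝟙 ⌊ x ≟ v ⌋
        ∎
      where
      open ≡-Reasoning
      old new gone : Fin n → ℤ
      old  w = 𝟙 (a w x)
      new  w = 𝟙 (⌊ w ≟ v ⌋ ∧ ⌊ x ≟ u ⌋)
      gone w = 𝟙 (⌊ w ≟ u ⌋ ∧ ⌊ x ≟ v ⌋)

    outdeg-flip : ∀ x → + outdeg a′ x ≡ + outdeg a x + 𝟙 ⌊ x ≟ v ⌋ - 𝟙 ⌊ x ≟ u ⌋
    outdeg-flip x = begin
      + outdeg a′ x
        ≡⟨ +sumℕ≡sum (λ w → boolToℕ (a′ x w)) ⟩
      ℤΣ.sum (λ w → 𝟙 (a′ x w))
        ≡⟨ ℤΣ.sum-cong-≗ (𝟙-flip x) ⟩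
      ℤΣ.sum (λ w → old w + new w - gone w)
        ≡⟨ ∑-distrib-+₃ old new (-_ ∘ gone) ⟩
      ℤΣ.sum old + ℤΣ.sum new + ℤΣ.sum (-_ ∘ gone)
        ≡⟨ cong₂ _+_ (cong₂ _+_ (sym (+sumℕ≡sum (λ w → boolToℕ (a x w))))
                                (∑-δ (λ c → 𝟙 (⌊ x ≟ v ⌋ ∧ c)) u (cong 𝟙 (∧-zeroʳ _))))
                     (∑-δ (λ c → - 𝟙 (⌊ x ≟ u ⌋ ∧ c)) v (cong (-_ ∘ 𝟙) (∧-zeroʳ _))) ⟩
      + outdeg a x + 𝟙 (⌊ x ≟ v ⌋ ∧ true) - 𝟙 (⌊ x ≟ u ⌋ ∧ true)
        ≡⟨ cong₂ (λ p q → + outdeg a x + 𝟙 p - 𝟙 q)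
                 (∧-identityʳ ⌊ x ≟ v ⌋) (∧-identityʳ ⌊ x ≟ u ⌋) ⟩
      + outdeg a x + 𝟙 ⌊ x ≟ v ⌋ - 𝟙 ⌊ x ≟ u ⌋
        ∎
      where
      open ≡-Reasoning
      old new gone : Fin n → ℤ
      old  w = 𝟙 (a x w)
      new  w = 𝟙 (⌊ x ≟ v ⌋ ∧ ⌊ w ≟ u ⌋)
      gone w = 𝟙 (⌊ x ≟ u ⌋ ∧ ⌊ w ≟ v ⌋)

    disc-flip : ∀ x → disc a′ x ≡ disc a x + + 2 * (𝟙 ⌊ x ≟ u ⌋ - 𝟙 ⌊ x ≟ v ⌋)
    disc-flip x = trans (cong₂ _-_ (indeg-flip x) (outdeg-flip x))
                        (shift (+ indeg a x) (+ outdeg a x) (𝟙 ⌊ x ≟ u ⌋) (𝟙 ⌊ x ≟ v ⌋))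
      where
      shift : ∀ i o p q → (i + p - q) - (o + q - p) ≡ (i - o) + + 2 * (p - q)
      shift = solve-∀

    disc²-flip : ∀ x → disc a′ x * disc a′ x ≡
                 disc a x * disc a x + (if ⌊ x ≟ u ⌋ then + 4 * disc a u + + 4 else + 0)
                                     + (if ⌊ x ≟ v ⌋ then + 4 - + 4 * disc a v else + 0)
    disc²-flip x rewrite disc-flip x with x ≟ u | x ≟ v
    ... | yes refl | yes u≡v  = ⊥-elim (u≢v u≡v)
    ... | yes refl | no _     = raised (disc a u)
      where
      raised : ∀ d → (d + + 2 * (+ 1 - + 0)) * (d + + 2 * (+ 1 - + 0)) ≡ d * d + (+ 4 * d + + 4) + + 0
      raised = solve-∀
    ... | no _     | yes refl = lowered (disc a v)
      where
      lowered : ∀ d → (d + + 2 * (+ 0 - + 1)) * (d + + 2 * (+ 0 - + 1)) ≡ d * d + + 0 + (+ 4 - + 4 * d)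
      lowered = solve-∀
    ... | no _     | no _     = unchanged (disc a x)
      where
      unchanged : ∀ d → (d + + 2 * (+ 0 - + 0)) * (d + + 2 * (+ 0 - + 0)) ≡ d * d + + 0 + + 0
      unchanged = solve-∀

    Φ-flip : Φ a′ ≡ Φ a + + 4 * (disc a u + + 2 - disc a v)
    Φ-flip = begin
      Φ a′
        ≡⟨ sumℤ≡sum (λ x → disc a′ x * disc a′ x) ⟩
      ℤΣ.sum (λ x → disc a′ x * disc a′ x)
        ≡⟨ ℤΣ.sum-cong-≗ disc²-flip ⟩
      ℤΣ.sum (λ x → sq x + at-u ⌊ x ≟ u ⌋ + at-v ⌊ x ≟ v ⌋)
        ≡⟨ ∑-distrib-+₃ sq (λ x → at-u ⌊ x ≟ u ⌋) (λ x → at-v ⌊ x ≟ v ⌋) ⟩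
      ℤΣ.sum sq + ℤΣ.sum (λ x → at-u ⌊ x ≟ u ⌋) + ℤΣ.sum (λ x → at-v ⌊ x ≟ v ⌋)
        ≡⟨ cong₂ _+_ (cong₂ _+_ (sym (sumℤ≡sum sq)) (∑-δ at-u u refl)) (∑-δ at-v v refl) ⟩
      Φ a + (+ 4 * du + + 4) + (+ 4 - + 4 * dv)
        ≡⟨ collect (Φ a) du dv ⟩
      Φ a + + 4 * (du + + 2 - dv)
        ∎
      where
      open ≡-Reasoning
      du dv : ℤ
      du = disc a u
      dv = disc a v
      sq : Fin n → ℤ
      sq x = disc a x * disc a x
      at-u at-v : Bool → ℤ
      at-u b = if b then + 4 * du + + 4 else + 0
      at-v b = if b then + 4 - + 4 * dv else + 0
      collect : ∀ p du dv → p + (+ 4 * du + + 4) + (+ 4 - + 4 * dv) ≡ p + + 4 * (du + + 2 - dv)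
      collect = solve-∀

  disc-step≤2⇒LocalOpt : ∀ {n} {a : Orientation n} → OrientedSimple a →
                         (∀ u v → T (a u v) → disc a v ≤ disc a u + + 2) → LocalOpt a
  disc-step≤2⇒LocalOpt {a = a} simple step u v u→v = begin
    Φ a
      ≡⟨ ℤ.+-identityʳ (Φ a) ⟨
    Φ a + + 0
      ≤⟨ ℤ.+-monoʳ-≤ (Φ a) (ℤ.*-monoˡ-≤-nonNeg (+ 4) (ℤ.i≤j⇒0≤j-i (step u v u→v))) ⟩
    Φ a + + 4 * (disc a u + + 2 - disc a v)
      ≡⟨ Φ-flip simple u→v ⟨
    Φ (flip a u v)
      ∎
    where open ℤ.≤-Reasoning

  a+b≤c+d+2⇒a-d≤c-b+2 : ∀ a b c d → a ℕ.+ b ℕ.≤ c ℕ.+ d ℕ.+ 2 → + a - + d ≤ + c - + b + + 2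
  a+b≤c+d+2⇒a-d≤c-b+2 a b c d h = begin
    + a - + d                         ≡⟨ pad (+ a) (+ b) (+ d) ⟩
    (+ a + + b) - (+ b + + d)         ≤⟨ ℤ.+-monoˡ-≤ (- (+ b + + d)) (ℤ.+≤+ h) ⟩
    (+ c + + d + + 2) - (+ b + + d)   ≡⟨ unpad (+ b) (+ c) (+ d) ⟩
    + c - + b + + 2                   ∎
    where
    open ℤ.≤-Reasoning
    pad : ∀ x y z → x - z ≡ (x + y) - (y + z)
    pad = solve-∀
    unpad : ∀ y x z → (x + z + + 2) - (y + z) ≡ x - y + + 2
    unpad = solve-∀

open import Data.Nat using (_+_; _*_; _^_; _∸_; _⊔_; _≤_; _<_; _≤?_; z≤n; s≤s; _≡ᵇ_; _<ᵇ_; NonZero)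

∑-↑ : ∀ m {n} (f : Fin (m + n) → ℕ) →
      ℕΣ.sum f ≡ ℕΣ.sum {m} (λ i → f (i ↑ˡ n)) + ℕΣ.sum {n} (λ j → f (m ↑ʳ j))
∑-↑ zero    f = refl
∑-↑ (suc m) f = trans (cong (_+_ (f zero)) (∑-↑ m (f ∘ suc))) (sym (ℕ.+-assoc (f zero) _ _))

∑-combine : ∀ m {n} (f : Fin (m * n) → ℕ) →
            ℕΣ.sum f ≡ ℕΣ.sum {m} (λ i → ℕΣ.sum {n} (λ j → f (combine i j)))
∑-combine zero    f = refl
∑-combine (suc m) {n} f =
  trans (∑-↑ n f) (cong (_+_ (ℕΣ.sum {n} (λ j → f (j ↑ˡ m * n)))) (∑-combine m (λ x → f (n ↑ʳ x))))

∑-<ᵇ-∧ : ∀ {w} q b → q ≤ w → ℕΣ.sum {w} (λ i → boolToℕ ((toℕ i <ᵇ q) ∧ b)) ≡ (if b then q else 0)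
∑-<ᵇ-∧ {w}     zero    true  _         = ℕΣ.sum-replicate-zero w
∑-<ᵇ-∧ {w}     zero    false _         = ℕΣ.sum-replicate-zero w
∑-<ᵇ-∧ {suc w} (suc q) true  (s≤s q≤w) = cong suc (∑-<ᵇ-∧ q true q≤w)
∑-<ᵇ-∧ {suc w} (suc q) false (s≤s q≤w) = ∑-<ᵇ-∧ q false q≤w

∑-select : ∀ {t} (f : ℕ → ℕ) k → (t ≤ k → f k ≡ 0) →
           ℕΣ.sum {t} (λ s → if toℕ s ≡ᵇ k then f (toℕ s) else 0) ≡ f k
∑-select {zero}  f k       vanish = sym (vanish z≤n)
∑-select {suc t} f zero    _      = trans (cong (_+_ (f 0)) (ℕΣ.sum-replicate-zero t)) (ℕ.+-identityʳ (f 0))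
∑-select {suc t} f (suc k) vanish = ∑-select (f ∘ suc) k (vanish ∘ s≤s)

below : (ℕ → ℕ) → ℕ → ℕ
below f zero    = 0
below f (suc l) = f l

∑-below : ∀ {t} (f : ℕ → ℕ) l → l ≤ t →
          ℕΣ.sum {t} (λ s → if suc (toℕ s) ≡ᵇ l then f (toℕ s) else 0) ≡ below f l
∑-below {t} f zero    _   = ℕΣ.sum-replicate-zero t
∑-below     f (suc k) k<t = ∑-select f k (λ t≤k → ⊥-elim (ℕ.<⇒≱ k<t t≤k))

≡ᵇ-sym : ∀ m n → (m ≡ᵇ n) ≡ (n ≡ᵇ m)
≡ᵇ-sym zero    zero    = refl
≡ᵇ-sym zero    (suc n) = refl
≡ᵇ-sym (suc m) zero    = refl
≡ᵇ-sym (suc m) (suc n) = ≡ᵇ-sym m n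

≤-foldr-⊔ : ∀ {n} (f : Fin n → ℕ) x → f x ≤ Vector.foldr _⊔_ 0 f
≤-foldr-⊔ f zero    = ℕ.m≤m⊔n (f zero) _
≤-foldr-⊔ f (suc x) = ℕ.≤-trans (≤-foldr-⊔ (f ∘ suc) x) (ℕ.m≤n⊔m (f zero) _)

∣disc∣≤discrepancy : ∀ {n} (a : Orientation n) v → ℤ.∣ disc a v ∣ ≤ discrepancy a
∣disc∣≤discrepancy a v =
  subst (ℤ.∣ disc a v ∣ ≤_) (sym (foldr-map-allFin _⊔_ 0 (λ x → ℤ.∣ disc a x ∣))) (≤-foldr-⊔ _ v)

-- The condition disc v ≤ disc u + 2 for the arcs u → v leaving layer l of Layered below.
Balanced : (ℕ → ℕ) → Set
Balanced size = ∀ l → size l + size (suc l) ≤ below size l + size (suc (suc l)) + 2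

-- Vertex combine l i is slot i of layer l; it is occupied when i < size l, and each occupied
-- vertex points to every occupied vertex of the next layer.
module Layered (depth width : ℕ) (size : ℕ → ℕ) where

  layer slot : Fin (depth * width) → ℕ
  layer v = toℕ (proj₁ (remQuot {depth} width v))
  slot  v = toℕ (proj₂ (remQuot {depth} width v))

  occupied : Fin (depth * width) → Bool
  occupied v = slot v <ᵇ size (layer v)

  orientation : Orientation (depth * width)
  orientation u v = occupied u ∧ (occupied v ∧ (suc (layer u) ≡ᵇ layer v))

  layer<depth : ∀ v → layer v < depth
  layer<depth v = toℕ<n (proj₁ (remQuot {depth} width v))

  layer-combine : ∀ (s : Fin depth) (i : Fin width) → layer (combine s i) ≡ toℕ s
  layer-combine s i = cong (toℕ ∘ proj₁) (remQuot-combine s i)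

  occupied-combine : ∀ (s : Fin depth) (i : Fin width) → occupied (combine s i) ≡ (toℕ i <ᵇ size (toℕ s))
  occupied-combine s i =
    cong₂ (λ l j → j <ᵇ size l) (layer-combine s i) (cong (toℕ ∘ proj₂) (remQuot-combine s i))

  arc-structure : ∀ {u v} → T (orientation u v) →
                  occupied u ≡ true × occupied v ≡ true × layer v ≡ suc (layer u)
  arc-structure {u} {v} t
    with occ-u , rest ← Equivalence.to (T-∧ {occupied u}) t
    with occ-v , adjacent ← Equivalence.to (T-∧ {occupied v}) rest
    = Equivalence.to T-≡ occ-u , Equivalence.to T-≡ occ-v , sym (ℕ.≡ᵇ⇒≡ _ _ adjacent)

  simple : OrientedSimple orientation
  simple = no-loop , antisymmetric
    where
    no-loop : ∀ v → orientation v v ≡ false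
    no-loop v with orientation v v in eq
    ... | false = refl
    ... | true  = ⊥-elim (ℕ.1+n≢n (sym (proj₂ (proj₂ (arc-structure (subst T (sym eq) tt))))))
    antisymmetric : ∀ u v → ¬ (T (orientation u v) × T (orientation v u))
    antisymmetric u v (u→v , v→u) =
      ℕ.<-asym (ℕ.≤-reflexive (sym (proj₂ (proj₂ (arc-structure u→v)))))
               (ℕ.≤-reflexive (sym (proj₂ (proj₂ (arc-structure v→u)))))

  module _ (fits : ∀ l → size l ≤ width) (top-empty : size depth ≡ 0) where

    indeg-occupied : ∀ v → occupied v ≡ true → indeg orientation v ≡ below size (layer v)
    indeg-occupied v occ = begin
      indeg orientation v
        ≡⟨ foldr-map-allFin _+_ 0 (λ x → boolToℕ (orientation x v)) ⟩
      ℕΣ.sum (λ x → boolToℕ (orientation x v))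
        ≡⟨ ∑-combine depth (λ x → boolToℕ (orientation x v)) ⟩
      ℕΣ.sum {depth} (λ s → ℕΣ.sum {width} (λ i → boolToℕ (orientation (combine s i) v)))
        ≡⟨ ℕΣ.sum-cong-≗ (λ s → ℕΣ.sum-cong-≗ (λ i → cong boolToℕ (from s i))) ⟩
      ℕΣ.sum {depth} (λ s → ℕΣ.sum {width} (λ i →
        boolToℕ ((toℕ i <ᵇ size (toℕ s)) ∧ (suc (toℕ s) ≡ᵇ layer v))))
        ≡⟨ ℕΣ.sum-cong-≗ {depth} (λ s → ∑-<ᵇ-∧ (size (toℕ s)) _ (fits (toℕ s))) ⟩
      ℕΣ.sum {depth} (λ s → if suc (toℕ s) ≡ᵇ layer v then size (toℕ s) else 0)
        ≡⟨ ∑-below size (layer v) (ℕ.<⇒≤ (layer<depth v)) ⟩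
      below size (layer v)
        ∎
      where
      open ≡-Reasoning
      from : ∀ s i → occupied (combine s i) ∧ (occupied v ∧ (suc (layer (combine s i)) ≡ᵇ layer v))
                   ≡ (toℕ i <ᵇ size (toℕ s)) ∧ (suc (toℕ s) ≡ᵇ layer v)
      from s i = trans (cong₂ (λ o l → o ∧ (occupied v ∧ (suc l ≡ᵇ layer v)))
                              (occupied-combine s i) (layer-combine s i))
                       (cong (λ o → (toℕ i <ᵇ size (toℕ s)) ∧ (o ∧ (suc (toℕ s) ≡ᵇ layer v))) occ)

    outdeg-occupied : ∀ u → occupied u ≡ true → outdeg orientation u ≡ size (suc (layer u))
    outdeg-occupied u occ = begin
      outdeg orientation u
        ≡⟨ foldr-map-allFin _+_ 0 (λ x → boolToℕ (orientation u x)) ⟩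
      ℕΣ.sum (λ x → boolToℕ (orientation u x))
        ≡⟨ ∑-combine depth (λ x → boolToℕ (orientation u x)) ⟩
      ℕΣ.sum {depth} (λ t → ℕΣ.sum {width} (λ j → boolToℕ (orientation u (combine t j))))
        ≡⟨ ℕΣ.sum-cong-≗ (λ t → ℕΣ.sum-cong-≗ (λ j → cong boolToℕ (to t j))) ⟩
      ℕΣ.sum {depth} (λ t → ℕΣ.sum {width} (λ j →
        boolToℕ ((toℕ j <ᵇ size (toℕ t)) ∧ (toℕ t ≡ᵇ suc (layer u)))))
        ≡⟨ ℕΣ.sum-cong-≗ {depth} (λ t → ∑-<ᵇ-∧ (size (toℕ t)) _ (fits (toℕ t))) ⟩
      ℕΣ.sum {depth} (λ t → if toℕ t ≡ᵇ suc (layer u) then size (toℕ t) else 0)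
        ≡⟨ ∑-select size (suc (layer u)) (λ depth≤ → trans (cong size (ℕ.≤-antisym (layer<depth u) depth≤))
                                                           top-empty) ⟩
      size (suc (layer u))
        ∎
      where
      open ≡-Reasoning
      to : ∀ t j → occupied u ∧ (occupied (combine t j) ∧ (suc (layer u) ≡ᵇ layer (combine t j)))
                 ≡ (toℕ j <ᵇ size (toℕ t)) ∧ (toℕ t ≡ᵇ suc (layer u))
      to t j = trans (cong (λ o → o ∧ (occupied (combine t j) ∧ (suc (layer u) ≡ᵇ layer (combine t j)))) occ)
                     (cong₂ _∧_ (occupied-combine t j)
                                (trans (cong (suc (layer u) ≡ᵇ_) (layer-combine t j))
                                       (≡ᵇ-sym (suc (layer u)) (toℕ t))))

    disc-occupied : ∀ v → occupied v ≡ true →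
                    disc orientation v ≡ + below size (layer v) ℤ.- + size (suc (layer v))
    disc-occupied v occ = cong₂ (λ i o → + i ℤ.- + o) (indeg-occupied v occ) (outdeg-occupied v occ)

    balanced⇒LocalOpt : Balanced size → LocalOpt orientation
    balanced⇒LocalOpt balanced = disc-step≤2⇒LocalOpt simple step
      where
      step : ∀ u v → T (orientation u v) → disc orientation v ℤ.≤ disc orientation u ℤ.+ + 2
      step u v u→v with occ-u , occ-v , v-above-u ← arc-structure u→v = begin
        disc orientation v
          ≡⟨ disc-occupied v occ-v ⟩
        + below size (layer v) ℤ.- + size (suc (layer v))
          ≡⟨ cong (λ l → + below size l ℤ.- + size (suc l)) v-above-u ⟩
        + size (layer u) ℤ.- + size (suc (suc (layer u)))
          ≤⟨ a+b≤c+d+2⇒a-d≤c-b+2 _ _ (below size (layer u)) _ (balanced (layer u)) ⟩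
        + below size (layer u) ℤ.- + size (suc (layer u)) ℤ.+ + 2
          ≡⟨ cong (ℤ._+ + 2) (disc-occupied u occ-u) ⟨
        disc orientation u ℤ.+ + 2
          ∎
        where open ℤ.≤-Reasoning

twice : (ℕ → ℕ) → ℕ → ℕ
twice p zero          = p 0
twice p (suc zero)    = p 0
twice p (suc (suc t)) = twice (p ∘ suc) t

twice-+ : ∀ p n → twice p (n + n) ≡ p n
twice-+ p zero    = refl
twice-+ p (suc n) rewrite ℕ.+-suc n n = twice-+ (p ∘ suc) n

twice-≤ : ∀ {p b} → (∀ k → p k ≤ b) → ∀ t → twice p t ≤ b
twice-≤ p≤b zero          = p≤b 0
twice-≤ p≤b (suc zero)    = p≤b 0
twice-≤ p≤b (suc (suc t)) = twice-≤ (p≤b ∘ suc) t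

Δ²≥-2 : (ℕ → ℕ) → Set
Δ²≥-2 p = ∀ s → p (suc s) + p (suc s) ≤ p s + p (suc (suc s)) + 2

-- For p itself, Balanced asks two consecutive second differences of p to add up to at least −2,
-- which fails for the tent (each is −2); for twice p every instance involves only one of them.
twice-balanced : ∀ {p} → p 0 ≡ 0 → Δ²≥-2 p → Balanced (twice p)
twice-balanced {p} p0≡0 Δ² zero    = subst (λ x → x + x ≤ p 1 + 2) (sym p0≡0) z≤n
twice-balanced     p0≡0 Δ² (suc l) = balanced-above Δ² l
  where
  balanced-above : ∀ {p} → Δ²≥-2 p →
                   ∀ l → twice p (suc l) + twice p (2 + l) ≤ twice p l + twice p (3 + l) + 2
  balanced-above Δ² zero          = ℕ.m≤m+n _ 2
  balanced-above Δ² (suc zero)    = Δ² 0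
  balanced-above Δ² (suc (suc l)) = balanced-above (Δ² ∘ suc) l

tent : ℕ → ℕ → ℕ
tent N k = k * (N ∸ k)

tent-≤ : ∀ N k → tent N k ≤ N * N
tent-≤ N k with ℕ.≤-total k N
... | inj₁ k≤N = ℕ.*-mono-≤ k≤N (ℕ.m∸n≤m N k)
... | inj₂ N≤k = ℕ.≤-trans (ℕ.≤-reflexive (trans (cong (k *_) (ℕ.m≤n⇒m∸n≡0 N≤k)) (ℕ.*-zeroʳ k))) z≤n

tent-end : ∀ N → tent N N ≡ 0
tent-end N = trans (cong (N *_) (ℕ.n∸n≡0 N)) (ℕ.*-zeroʳ N)

tent-Δ² : ∀ N → Δ²≥-2 (tent N)
tent-Δ² N s with 2 + s ≤? N
... | no 2+s≰N = begin
  tent N (suc s) + tent N (suc s)   ≡⟨ cong (λ x → x + x) vanishes ⟩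
  0                                 ≤⟨ z≤n ⟩
  tent N s + tent N (2 + s) + 2     ∎
  where
  open ℕ.≤-Reasoning
  vanishes : tent N (suc s) ≡ 0
  vanishes = trans (cong (suc s *_) (ℕ.m≤n⇒m∸n≡0 (ℕ.s≤s⁻¹ (ℕ.≰⇒> 2+s≰N)))) (ℕ.*-zeroʳ (suc s))
... | yes 2+s≤N with o , refl ← ℕ.m≤n⇒∃[o]m+o≡n 2+s≤N = ℕ.≤-reflexive (begin
  suc s * (suc (s + o) ∸ s) + suc s * (suc (s + o) ∸ s)
    ≡⟨ cong (λ x → suc s * x + suc s * x) (beyond 1) ⟩
  suc s * suc o + suc s * suc o
    ≡⟨ exact s o ⟩
  s * (2 + o) + (2 + s) * o + 2
    ≡⟨ cong₂ (λ x y → s * x + (2 + s) * y + 2) (beyond 2) (beyond 0) ⟨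
  s * (2 + s + o ∸ s) + (2 + s) * (s + o ∸ s) + 2
    ∎)
  where
  open ≡-Reasoning
  beyond : ∀ k → k + (s + o) ∸ s ≡ k + o
  beyond k = trans (ℕ.+-∸-assoc k (ℕ.m≤m+n s o)) (cong (_+_ k) (ℕ.m+n∸m≡n s o))
  exact : ∀ s o → suc s * suc o + suc s * suc o ≡ s * (2 + o) + (2 + s) * o + 2
  exact = ℕ-solve-∀

module TentLayers (c : ℕ) where

  d N : ℕ
  d = suc c
  N = suc d

  open Layered (N + N) (N * N) (twice (tent N)) public

  fits : ∀ l → twice (tent N) l ≤ N * N
  fits = twice-≤ (tent-≤ N)

  top-empty : twice (tent N) (N + N) ≡ 0
  top-empty = trans (twice-+ (tent N) N) (tent-end N)

  localOpt : LocalOpt orientation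
  localOpt = balanced⇒LocalOpt fits top-empty (twice-balanced refl (tent-Δ² N))

  2<N+N : 2 < N + N
  2<N+N = s≤s (s≤s (ℕ.≤-trans (s≤s z≤n) (ℕ.m≤n+m N c)))

  peak-layer : Fin (N + N)
  peak-layer = fromℕ< 2<N+N

  peak-slot : Fin (N * N)
  peak-slot = zero

  peak : Fin ((N + N) * (N * N))
  peak = combine peak-layer peak-slot

  ∣disc-peak∣ : ℤ.∣ disc orientation peak ∣ ≡ d
  ∣disc-peak∣ = begin
    ℤ.∣ disc orientation peak ∣
      ≡⟨ cong ℤ.∣_∣ (disc-occupied fits top-empty peak occupied-peak) ⟩
    ℤ.∣ + below (twice (tent N)) (layer peak) ℤ.- + twice (tent N) (suc (layer peak)) ∣
      ≡⟨ cong (λ l → ℤ.∣ + below (twice (tent N)) l ℤ.- + twice (tent N) (suc l) ∣) layer-peak ⟩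
    ℤ.∣ + 0 ℤ.- + tent N 1 ∣
      ≡⟨ cong ℤ.∣_∣ (ℤ.+-identityˡ (ℤ.- + tent N 1)) ⟩
    ℤ.∣ ℤ.- + tent N 1 ∣
      ≡⟨ ℤ.∣-i∣≡∣i∣ (+ tent N 1) ⟩
    1 * d
      ≡⟨ ℕ.*-identityˡ d ⟩
    d ∎
    where
    open ≡-Reasoning
    layer-peak : layer peak ≡ 2
    layer-peak = trans (layer-combine peak-layer peak-slot) (toℕ-fromℕ< 2<N+N)
    occupied-peak : occupied peak ≡ true
    occupied-peak = trans (occupied-combine peak-layer peak-slot)
                          (cong (λ l → 0 <ᵇ twice (tent N) l) (toℕ-fromℕ< 2<N+N))

  d≤discrepancy : d ≤ discrepancy orientation
  d≤discrepancy = ℕ.≤-trans (ℕ.≤-reflexive (sym ∣disc-peak∣)) (∣disc∣≤discrepancy orientation peak)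

  c≤order : c ≤ (N + N) * (N * N)
  c≤order = ℕ.≤-trans (ℕ.≤-trans (ℕ.m≤n+m c 2) (ℕ.m≤m+n N N)) (ℕ.m≤m*n (N + N) (N * N))

  order≤16discrepancy³ : (N + N) * (N * N) ≤ 16 * discrepancy orientation ^ 3
  order≤16discrepancy³ = begin
    (N + N) * (N * N)
      ≤⟨ ℕ.*-mono-≤ (ℕ.+-mono-≤ N≤d+d N≤d+d) (ℕ.*-mono-≤ N≤d+d N≤d+d) ⟩
    (d + d + (d + d)) * ((d + d) * (d + d))
      ≡⟨ cube d ⟩
    16 * d ^ 3
      ≤⟨ ℕ.*-monoʳ-≤ 16 (ℕ.^-monoˡ-≤ 3 d≤discrepancy) ⟩
    16 * discrepancy orientation ^ 3
      ∎
    where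
    open ℕ.≤-Reasoning
    N≤d+d : N ≤ d + d
    N≤d+d = ℕ.+-monoˡ-≤ d (s≤s z≤n)
    cube : ∀ d → (d + d + (d + d)) * ((d + d) * (d + d)) ≡ 16 * (d * (d * (d * 1)))
    cube = ℕ-solve-∀

lemma4p2 : Σ ℕ λ k → NonZero k ×
    ((N : ℕ) → Σ ℕ λ n → N ≤ n × Σ (Orientation n) λ a →
      OrientedSimple a × LocalOpt a × n ≤ k * discrepancy a ^ 3)
lemma4p2 = 16 , _ , λ c → let open TentLayers c in
  _ , c≤order , orientation , simple , localOpt , order≤16discrepancy³
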